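{- If $L\subseteq\{0,1\}^*$ is a finite 0-1-symmetric language, then $\mathcal{G}_L$ does not contain all graphs.
   Context: All graphs are finite, simple, undirected, with nonempty vertex sets, and graph classes are considered up to isomorphism. For $w\in\{0,1\}^*$ let $\widetilde{w}$ be obtained from $w$ by exchanging the letters 0 and 1; a language $L\subseteq\{0,1\}^*$ is 0-1-symmetric if $L=\{\widetilde w : w\in L\}$. For an alphabet $V$ and distinct $u,v\in V$, $h_{u,v}:V^*\to\{0,1\}^*$ is the monoid morphism with $u\mapsto 0$, $v\mapsto 1$ and $x\mapsto\lambda$ (empty word) for all other letters $x$. For a 0-1-symmetric $L$ and a nonempty word $w$ whose set of occurring letters is $V$, $G(L,w)$ is the graph with vertex set $V$ in which distinct $u,v$ are adjacent iff $h_{u,v}(w)\in L$. A graph is $L$-representable if it is isomorphic to some $G(L,w)$, and $\mathcal{G}_L$ denotes the class of all $L$-representable graphs. -}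

module Defs where

open import Level using (0ℓ)
open import Data.Bool using (Bool; true; false; not)
open import Data.Nat using (ℕ; suc)
open import Data.Fin using (Fin; _≟_)
open import Data.List using (List; []; _∷_; map)
open import Data.List.Membership.Propositional using (_∈_)
open import Data.Product using (Σ; ∃; _×_; _,_)
open import Relation.Nullary using (¬_; yes; no)
open import Relation.Binary.PropositionalEquality using (_≡_; _≢_)
open import Function.Bundles using (Inverse; _↔_; _⇔_)

-- The binary alphabet {0,1}: false = 0, true = 1.
-- A finite language L ⊆ {0,1}* is given by the (finite) list of its words.
Language : Set
Language = List (List Bool)

swap01 : List Bool → List Bool
swap01 = map not

-- L is 0-1-symmetric: L = { w̃ : w ∈ L }.  Since ~ is an involution,
-- this is equivalent to closure of L under ~ (both inclusions reduce to it);
-- we state both inclusions literally.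
ZeroOneSymmetric : Language → Set
ZeroOneSymmetric L =
  (∀ w → w ∈ L → ∃ λ v → v ∈ L × w ≡ swap01 v) ×
  (∀ v → v ∈ L → swap01 v ∈ L)

h : ∀ {m} → Fin m → Fin m → List (Fin m) → List Bool
h u v [] = []
h u v (x ∷ w) with x ≟ u | x ≟ v
... | yes _ | _     = false ∷ h u v w
... | no _  | yes _ = true ∷ h u v w
... | no _  | no _  = h u v w

record Graph (n : ℕ) : Set₁ where
  field
    Adj     : Fin n → Fin n → Set
    irrefl  : ∀ u → ¬ Adj u u
    sym     : ∀ u v → Adj u v → Adj v u
open Graph public

-- Adjacency of G(L,w), where the vertex set (= set of letters of w)
-- is Fin m (with every letter of Fin m occurring in w).
GAdj : ∀ {m} → Language → List (Fin m) → Fin m → Fin m → Set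
GAdj L w u v = u ≢ v × h u v w ∈ L

Representable : ∀ {n} → Language → Graph n → Set
Representable {n} L G =
  Σ ℕ λ m → Σ (List (Fin m)) λ w →
    (w ≢ []) × (∀ x → x ∈ w) ×
    Σ (Fin n ↔ Fin m) λ f →
      ∀ u v → Adj G u v ⇔ GAdj L w (Inverse.to f u) (Inverse.to f v)

module Submission where

-- Let N be the maximal length of a word of L. If uv is an edge of G(L,w) then h_{u,v}(w) ∈ L, so
-- every non-isolated vertex occurs at most N times in w. Take the bipartite graph with parts
-- A = {a₀,…,aₘ} and B = {b_t : t < 2^m}, where a₀ is adjacent to all of B and aᵢ₊₁ to b_t iff
-- the i-th binary digit of t is 1, so that distinct b_t have distinct neighbourhoods. The
-- neighbourhood of b in A is determined by the subword of w on A ∪ {b}, i.e. by the subword of w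
-- on A (the same for every b, of length at most (m+1)N) with at most N copies of b inserted.
-- There are at most ((m+1)N+2)^N such words, fewer than 2^m for m large.

open import Defs hiding (sym)
open import Data.Bool using (false; true)
open import Data.Empty using (⊥)
open import Data.Fin using (Fin; zero; suc; _≟_; _↑ˡ_; _↑ʳ_; splitAt; join; combine; finToFun; funToFin)
open import Data.Fin.Properties
  using (splitAt-↑ˡ; splitAt-↑ʳ; splitAt-join; join-splitAt; injective⇒≤; funToFin-finToFin; finToFun-funToFin)
open import Data.List using (List; []; _∷_; _++_; map; length; filter; mapMaybe; lookup)
open import Data.List.Extrema.Nat using (max; xs≤max)
open import Data.List.Membership.Propositional using (_∈_)
open import Data.List.Membership.Propositional.Properties using (∈-map⁺; ∈-++⁺ˡ; ∈-++⁺ʳ)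
open import Data.List.Properties using (filter-accept; filter-reject; length-map; length-++; mapMaybe-cong)
open import Data.List.Relation.Unary.All as All using ()
open import Data.List.Relation.Unary.Any using (here; there; index)
open import Data.List.Relation.Unary.Any.Properties using (lookup-index)
open import Data.Maybe using (Maybe; just; nothing; _>>=_)
open import Data.Maybe.Properties using (just-injective)
open import Data.Nat using (ℕ; zero; suc; _+_; _*_; _^_; _≤_; _<_; z≤n; s≤s)
open import Data.Nat.Properties
  using ( ≤-refl; ≤-trans; <⇒≱; n≤1+n; m≤n⇒m≤1+n; m≤m+n; m≤n+m; +-comm; +-suc; +-identityʳ
        ; +-mono-≤; +-monoˡ-≤; +-monoʳ-≤; *-mono-≤; *-monoˡ-≤; *-monoʳ-≤
        ; m^n>0; ^-monoˡ-≤; ^-monoʳ-<; ^-distribˡ-+-*; ^-*-assoc; module ≤-Reasoning )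
open import Data.Nat.Tactic.RingSolver using (solve-∀)
open import Data.Product using (Σ; ∃; _×_; _,_; proj₂)
open import Data.Sum using (_⊎_; inj₁; inj₂; isInj₁)
open import Data.Unit using (⊤; tt)
open import Function using (_∘_)
open import Function.Bundles using (Inverse; Equivalence; _⇔_; mk⇔)
open import Function.Construct.Composition using (_⇔-∘_)
open import Function.Construct.Identity using (⇔-id)
open import Function.Construct.Symmetry using (⇔-sym)
open import Relation.Binary.PropositionalEquality
open import Relation.Nullary using (¬_; yes; no; contradiction)

occurrences : ∀ {n} → Fin n → List (Fin n) → ℕ
occurrences x w = length (filter (_≟ x) w)

occurrences-∷-same : ∀ {n} (x : Fin n) w → occurrences x (x ∷ w) ≡ suc (occurrences x w)
occurrences-∷-same x w = cong length (filter-accept (_≟ x) refl)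

occurrences-∷-other : ∀ {n} {x y : Fin n} w → y ≢ x → occurrences x (y ∷ w) ≡ occurrences x w
occurrences-∷-other w y≢x = cong length (filter-reject (_≟ _) y≢x)

h-∷ˡ : ∀ {n} (u v : Fin n) w → h u v (u ∷ w) ≡ false ∷ h u v w
h-∷ˡ u v w with u ≟ u
... | yes _ = refl
... | no u≢u = contradiction refl u≢u

h-∷ʳ : ∀ {n} {u v : Fin n} w → u ≢ v → h u v (v ∷ w) ≡ true ∷ h u v w
h-∷ʳ {u = u} {v} w u≢v with v ≟ u | v ≟ v
... | yes v≡u | _ = contradiction (sym v≡u) u≢v
... | no _ | yes _ = refl
... | no _ | no v≢v = contradiction refl v≢v

h-∷-other : ∀ {n} {u v x : Fin n} w → x ≢ u → x ≢ v → h u v (x ∷ w) ≡ h u v w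
h-∷-other {u = u} {v} {x} w x≢u x≢v with x ≟ u | x ≟ v
... | yes x≡u | _ = contradiction x≡u x≢u
... | no _ | yes x≡v = contradiction x≡v x≢v
... | no _ | no _ = refl

OnlyPreimage : ∀ {A B : Set} → (A → Maybe B) → A → B → Set
OnlyPreimage σ x y = σ x ≡ just y × (∀ z → σ z ≡ just y → z ≡ x)

mapMaybe-just∷ : ∀ {A B : Set} (σ : A → Maybe B) {x y} w → σ x ≡ just y → mapMaybe σ (x ∷ w) ≡ y ∷ mapMaybe σ w
mapMaybe-just∷ σ w σx≡y rewrite σx≡y = refl

module _ {n n' : ℕ} (σ : Fin n → Maybe (Fin n')) where

  h-mapMaybe : ∀ {u v u' v'} → OnlyPreimage σ u u' → OnlyPreimage σ v v' →
               ∀ w → h u' v' (mapMaybe σ w) ≡ h u v w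
  h-mapMaybe σu σv [] = refl
  h-mapMaybe {u} {v} {u'} {v'} σu@(σu≡u' , only-u) σv@(σv≡v' , only-v) (x ∷ w)
    with x ≟ u | x ≟ v
  ... | yes refl | _ = begin
    h u' v' (mapMaybe σ (u ∷ w))    ≡⟨ cong (h u' v') (mapMaybe-just∷ σ w σu≡u') ⟩
    h u' v' (u' ∷ mapMaybe σ w)     ≡⟨ h-∷ˡ u' v' _ ⟩
    false ∷ h u' v' (mapMaybe σ w)  ≡⟨ cong (false ∷_) (h-mapMaybe σu σv w) ⟩
    false ∷ h u v w                 ∎
    where open ≡-Reasoning
  ... | no x≢u | yes refl = begin
    h u' v' (mapMaybe σ (v ∷ w))    ≡⟨ cong (h u' v') (mapMaybe-just∷ σ w σv≡v') ⟩
    h u' v' (v' ∷ mapMaybe σ w)     ≡⟨ h-∷ʳ _ (λ u'≡v' → x≢u (only-u v (trans σv≡v' (cong just (sym u'≡v'))))) ⟩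
    true ∷ h u' v' (mapMaybe σ w)   ≡⟨ cong (true ∷_) (h-mapMaybe σu σv w) ⟩
    true ∷ h u v w                  ∎
    where open ≡-Reasoning
  ... | no x≢u | no x≢v with σ x in σx
  ...   | nothing = h-mapMaybe σu σv w
  ...   | just y = trans (h-∷-other {x = y} _ (x≢u ∘ only-u x ∘ preimage) (x≢v ∘ only-v x ∘ preimage))
                         (h-mapMaybe σu σv w)
    where
      preimage : ∀ {y'} → y ≡ y' → σ x ≡ just y'
      preimage refl = σx

  occurrences-mapMaybe : ∀ {x y} → OnlyPreimage σ x y →
                         ∀ w → occurrences y (mapMaybe σ w) ≡ occurrences x w
  occurrences-mapMaybe σx [] = refl
  occurrences-mapMaybe {x} {y} σx@(σx≡y , only-x) (z ∷ w) with z ≟ x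
  ... | yes refl = begin
    occurrences y (mapMaybe σ (x ∷ w))  ≡⟨ cong (occurrences y) (mapMaybe-just∷ σ w σx≡y) ⟩
    occurrences y (y ∷ mapMaybe σ w)    ≡⟨ occurrences-∷-same y _ ⟩
    suc (occurrences y (mapMaybe σ w))  ≡⟨ cong suc (occurrences-mapMaybe σx w) ⟩
    suc (occurrences x w)               ∎
    where open ≡-Reasoning
  ... | no z≢x with σ z in σz
  ...   | nothing = occurrences-mapMaybe σx w
  ...   | just y' = begin
    occurrences y (y' ∷ mapMaybe σ w)  ≡⟨ occurrences-∷-other {x = y} {y = y'} _ (λ { refl → z≢x (only-x z σz) }) ⟩
    occurrences y (mapMaybe σ w)       ≡⟨ occurrences-mapMaybe σx w ⟩
    occurrences x w                    ∎
    where open ≡-Reasoning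

occurrences≤length-h : ∀ {n} (u v : Fin n) w → occurrences u w ≤ length (h u v w)
occurrences≤length-h u v [] = z≤n
occurrences≤length-h u v (x ∷ w) with x ≟ u | x ≟ v
... | yes _ | _     = s≤s (occurrences≤length-h u v w)
... | no _  | yes _ = m≤n⇒m≤1+n (occurrences≤length-h u v w)
... | no _  | no _  = occurrences≤length-h u v w

mapMaybe-mapMaybe : ∀ {A B C : Set} (f : A → Maybe B) (g : B → Maybe C) xs →
                    mapMaybe g (mapMaybe f xs) ≡ mapMaybe (λ x → f x >>= g) xs
mapMaybe-mapMaybe f g [] = refl
mapMaybe-mapMaybe f g (x ∷ xs) with f x
... | nothing = mapMaybe-mapMaybe f g xs
... | just y with g y
...   | nothing = mapMaybe-mapMaybe f g xs
...   | just z  = cong (z ∷_) (mapMaybe-mapMaybe f g xs)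

unsuc : ∀ {k} → Fin (suc k) → Maybe (Fin k)
unsuc zero    = nothing
unsuc (suc i) = just i

unsuc-onlyPreimage : ∀ {k} (i : Fin k) → OnlyPreimage unsuc (suc i) i
unsuc-onlyPreimage i = refl , λ { (suc j) refl → refl }

length≡occurrences-zero+length-unsuc : ∀ {k} (xs : List (Fin (suc k))) →
  length xs ≡ occurrences zero xs + length (mapMaybe unsuc xs)
length≡occurrences-zero+length-unsuc []           = refl
length≡occurrences-zero+length-unsuc (zero ∷ xs)  = cong suc (length≡occurrences-zero+length-unsuc xs)
length≡occurrences-zero+length-unsuc (suc i ∷ xs) =
  trans (cong suc (length≡occurrences-zero+length-unsuc xs)) (sym (+-suc _ _))

occurrences≤⇒length≤* : ∀ {k} N (xs : List (Fin k)) → (∀ i → occurrences i xs ≤ N) → length xs ≤ k * N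
occurrences≤⇒length≤* {zero}  N []       _ = z≤n
occurrences≤⇒length≤* {zero}  N (() ∷ _) _
occurrences≤⇒length≤* {suc k} N xs occurrences≤N = begin
  length xs                                         ≡⟨ length≡occurrences-zero+length-unsuc xs ⟩
  occurrences zero xs + length (mapMaybe unsuc xs)  ≤⟨ +-mono-≤ (occurrences≤N zero) length-unsuc≤ ⟩
  N + k * N                                         ∎
  where
    open ≤-Reasoning
    length-unsuc≤ : length (mapMaybe unsuc xs) ≤ k * N
    length-unsuc≤ = occurrences≤⇒length≤* N (mapMaybe unsuc xs) λ i →
      subst (_≤ N) (sym (occurrences-mapMaybe unsuc (unsuc-onlyPreimage i) xs)) (occurrences≤N (suc i))

-- The words over Fin (suc k) with at most n zeros whose other letters, decremented, spell xs.
interleavings : ∀ {k} → ℕ → List (Fin k) → List (List (Fin (suc k)))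
interleavings zero    xs       = map suc xs ∷ []
interleavings (suc n) []       = [] ∷ map (zero ∷_) (interleavings n [])
interleavings (suc n) (x ∷ xs) =
  map (suc x ∷_) (interleavings (suc n) xs) ++ map (zero ∷_) (interleavings n (x ∷ xs))

suc∷∈-interleavings : ∀ {k} n {x : Fin k} {xs ys} →
  ys ∈ interleavings n xs → suc x ∷ ys ∈ interleavings n (x ∷ xs)
suc∷∈-interleavings zero    (here ys≡) = here (cong (suc _ ∷_) ys≡)
suc∷∈-interleavings (suc n) ys∈        = ∈-++⁺ˡ (∈-map⁺ (suc _ ∷_) ys∈)

zero∷∈-interleavings : ∀ {k} n {xs : List (Fin k)} {ys} →
  ys ∈ interleavings n xs → zero ∷ ys ∈ interleavings (suc n) xs
zero∷∈-interleavings n {[]}     ys∈ = there (∈-map⁺ (zero ∷_) ys∈)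
zero∷∈-interleavings n {x ∷ xs} ys∈ =
  ∈-++⁺ʳ (map (suc x ∷_) (interleavings (suc n) xs)) (∈-map⁺ (zero ∷_) ys∈)

∈-interleavings : ∀ {k} n (ys : List (Fin (suc k))) →
  occurrences zero ys ≤ n → ys ∈ interleavings n (mapMaybe unsuc ys)
∈-interleavings zero    []            _         = here refl
∈-interleavings (suc n) []            _         = here refl
∈-interleavings (suc n) (zero ∷ ys)   (s≤s ≤n)  = zero∷∈-interleavings n (∈-interleavings n ys ≤n)
∈-interleavings n       (suc y ∷ ys)  ≤n        = suc∷∈-interleavings n (∈-interleavings n ys ≤n)

length-interleavings : ∀ {k} n (xs : List (Fin k)) → length (interleavings n xs) ≤ (2 + length xs) ^ n
length-interleavings zero    xs       = ≤-refl
length-interleavings (suc n) []       = begin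
  suc (length (map (zero ∷_) (interleavings n [])))  ≡⟨ cong suc (length-map (zero ∷_) (interleavings n [])) ⟩
  suc (length (interleavings n []))                  ≤⟨ s≤s (length-interleavings n []) ⟩
  suc (2 ^ n)                                        ≤⟨ +-monoˡ-≤ (2 ^ n) (m^n>0 2 n) ⟩
  2 ^ n + 2 ^ n                                      ≡⟨ cong (2 ^ n +_) (+-identityʳ (2 ^ n)) ⟨
  2 ^ suc n                                          ∎
  where open ≤-Reasoning
length-interleavings (suc n) (x ∷ xs) = begin
  length (map (suc x ∷_) (interleavings (suc n) xs) ++ map (zero ∷_) (interleavings n (x ∷ xs)))
    ≡⟨ length-++ (map (suc x ∷_) (interleavings (suc n) xs)) ⟩
  length (map (suc x ∷_) (interleavings (suc n) xs)) + length (map (zero ∷_) (interleavings n (x ∷ xs)))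
    ≡⟨ cong₂ _+_ (length-map (suc x ∷_) (interleavings (suc n) xs)) (length-map (zero ∷_) (interleavings n (x ∷ xs))) ⟩
  length (interleavings (suc n) xs) + length (interleavings n (x ∷ xs))
    ≤⟨ +-mono-≤ (length-interleavings (suc n) xs) (length-interleavings n (x ∷ xs)) ⟩
  (2 + l) * (2 + l) ^ n + (3 + l) ^ n
    ≤⟨ +-monoˡ-≤ ((3 + l) ^ n) (*-monoʳ-≤ (2 + l) (^-monoˡ-≤ n (n≤1+n (2 + l)))) ⟩
  (2 + l) * (3 + l) ^ n + (3 + l) ^ n
    ≡⟨ +-comm ((2 + l) * (3 + l) ^ n) ((3 + l) ^ n) ⟩
  (3 + l) ^ suc n
    ∎
  where
    open ≤-Reasoning
    l = length xs

-- Representations of graphs by words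

maxLength : Language → ℕ
maxLength L = max 0 (map length L)

length≤maxLength : ∀ {L w} → w ∈ L → length w ≤ maxLength L
length≤maxLength {L} w∈L = All.lookup (xs≤max 0 (map length L)) (∈-map⁺ length w∈L)

Represents : ∀ {n} → Language → Graph n → List (Fin n) → Set
Represents L G W = ∀ u v → Adj G u v ⇔ GAdj L W u v

representable⇒represented : ∀ {n L} {G : Graph n} → Representable L G → Σ (List (Fin n)) (Represents L G)
representable⇒represented {L = L} (_ , w , _ , _ , f , adj⇔) =
  mapMaybe (just ∘ from) w , λ u v → GAdj-transport u v ⇔-∘ adj⇔ u v
  where
    open Inverse f
    to-injective : ∀ {u v} → to u ≡ to v → u ≡ v
    to-injective {u} {v} to-u≡to-v = trans (sym (strictlyInverseʳ u)) (trans (cong from to-u≡to-v) (strictlyInverseʳ v))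
    from-onlyPreimage : ∀ u → OnlyPreimage (just ∘ from) (to u) u
    from-onlyPreimage u = cong just (strictlyInverseʳ u) ,
                          λ z from-z≡u → trans (sym (strictlyInverseˡ z)) (cong to (just-injective from-z≡u))
    h-transport : ∀ u v → h u v (mapMaybe (just ∘ from) w) ≡ h (to u) (to v) w
    h-transport u v = h-mapMaybe (just ∘ from) (from-onlyPreimage u) (from-onlyPreimage v) w
    GAdj-transport : ∀ u v → GAdj L w (to u) (to v) ⇔ GAdj L (mapMaybe (just ∘ from) w) u v
    GAdj-transport u v = mk⇔
      (λ (to-u≢to-v , h∈L) → (to-u≢to-v ∘ cong to) , subst (_∈ L) (sym (h-transport u v)) h∈L)
      (λ (u≢v , h∈L) → (u≢v ∘ to-injective) , subst (_∈ L) (h-transport u v) h∈L)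

occurrences≤maxLength : ∀ {n L} {G : Graph n} {W} → Represents L G W →
                        ∀ {u v} → Adj G u v → occurrences u W ≤ maxLength L
occurrences≤maxLength {W = W} rep {u} {v} u~v =
  ≤-trans (occurrences≤length-h u v W) (length≤maxLength (proj₂ (Equivalence.to (rep u v) u~v)))

-- Bipartite graphs

splitAt-onlyPreimage : ∀ {p q} {B : Set} {τ : Fin p ⊎ Fin q → Maybe B} {a y} →
  OnlyPreimage τ a y → OnlyPreimage (τ ∘ splitAt p) (join p q a) y
splitAt-onlyPreimage {p} {q} {τ = τ} {a} (τa≡y , only-a) =
  trans (cong τ (splitAt-join p q a)) τa≡y ,
  λ z τz≡y → trans (sym (join-splitAt p q z)) (cong (join p q) (only-a (splitAt p z) τz≡y))

isInj₁-onlyPreimage : ∀ {A B : Set} (x : A) → OnlyPreimage (isInj₁ {B = B}) (inj₁ x) x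
isInj₁-onlyPreimage x = refl , λ { (inj₁ _) refl → refl }

module _ {p q : ℕ} (R : Fin p → Fin q → Set) where

  Biadjacent : Fin p ⊎ Fin q → Fin p ⊎ Fin q → Set
  Biadjacent (inj₁ i) (inj₂ t) = R i t
  Biadjacent (inj₂ t) (inj₁ i) = R i t
  Biadjacent (inj₁ _) (inj₁ _) = ⊥
  Biadjacent (inj₂ _) (inj₂ _) = ⊥

  bipartite : Graph (p + q)
  bipartite = record
    { Adj    = λ u v → Biadjacent (splitAt p u) (splitAt p v)
    ; irrefl = λ u → Biadjacent-irrefl (splitAt p u)
    ; sym    = λ u v → Biadjacent-sym (splitAt p u) (splitAt p v)
    }
    where
      Biadjacent-irrefl : ∀ a → ¬ Biadjacent a a
      Biadjacent-irrefl (inj₁ _) ()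
      Biadjacent-irrefl (inj₂ _) ()
      Biadjacent-sym : ∀ a b → Biadjacent a b → Biadjacent b a
      Biadjacent-sym (inj₁ _) (inj₂ _) r = r
      Biadjacent-sym (inj₂ _) (inj₁ _) r = r

  Adj-bipartite : ∀ i t → R i t ⇔ Adj bipartite (i ↑ˡ q) (p ↑ʳ t)
  Adj-bipartite i t rewrite splitAt-↑ˡ p i q | splitAt-↑ʳ p q t = ⇔-id _

↑ˡ≢↑ʳ : ∀ {p q} (i : Fin p) (t : Fin q) → i ↑ˡ q ≢ p ↑ʳ t
↑ˡ≢↑ʳ {p} {q} i t i≡t with trans (sym (splitAt-↑ˡ p i q)) (trans (cong (splitAt p) i≡t) (splitAt-↑ʳ p q t))
... | ()

mark : ∀ {p q} → Fin q → Fin p ⊎ Fin q → Maybe (Fin (suc p))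
mark t (inj₁ i) = just (suc i)
mark t (inj₂ t') with t' ≟ t
... | yes _ = just zero
... | no _  = nothing

module _ {p q : ℕ} (t : Fin q) where

  mark-onlyPreimage-inj₁ : (i : Fin p) → OnlyPreimage (mark t) (inj₁ i) (suc i)
  mark-onlyPreimage-inj₁ i = refl , only-inj₁
    where
      only-inj₁ : ∀ a → mark t a ≡ just (suc i) → a ≡ inj₁ i
      only-inj₁ (inj₁ _) refl = refl
      only-inj₁ (inj₂ t') _ with t' ≟ t
      only-inj₁ (inj₂ t') () | yes _
      only-inj₁ (inj₂ t') () | no _

  mark-onlyPreimage-inj₂ : OnlyPreimage (mark {p} t) (inj₂ t) zero
  mark-onlyPreimage-inj₂ = mark-self , only-inj₂
    where
      mark-self : mark t (inj₂ t) ≡ just zero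
      mark-self with t ≟ t
      ... | yes _  = refl
      ... | no t≢t = contradiction refl t≢t
      only-inj₂ : ∀ a → mark t a ≡ just zero → a ≡ inj₂ t
      only-inj₂ (inj₂ t') _ with t' ≟ t
      only-inj₂ (inj₂ t') _  | yes t'≡t = cong inj₂ t'≡t
      only-inj₂ (inj₂ t') () | no _

  mark->>=unsuc : (a : Fin p ⊎ Fin q) → (mark t a >>= unsuc) ≡ isInj₁ a
  mark->>=unsuc (inj₁ _) = refl
  mark->>=unsuc (inj₂ t') with t' ≟ t
  ... | yes _ = refl
  ... | no _  = refl

module Traces {p q : ℕ} (W : List (Fin (p + q))) where

  traceA : List (Fin p)
  traceA = mapMaybe (isInj₁ ∘ splitAt p) W

  -- The subword of W on the letters i ↑ˡ q (renamed suc i) and p ↑ʳ t (renamed zero).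
  trace : Fin q → List (Fin (suc p))
  trace t = mapMaybe (mark t ∘ splitAt p) W

  occurrences-traceA : ∀ i → occurrences i traceA ≡ occurrences (i ↑ˡ q) W
  occurrences-traceA i = occurrences-mapMaybe _ (splitAt-onlyPreimage (isInj₁-onlyPreimage i)) W

  occurrences-zero-trace : ∀ t → occurrences zero (trace t) ≡ occurrences (p ↑ʳ t) W
  occurrences-zero-trace t = occurrences-mapMaybe _ (splitAt-onlyPreimage (mark-onlyPreimage-inj₂ t)) W

  unsuc-trace : ∀ t → mapMaybe unsuc (trace t) ≡ traceA
  unsuc-trace t = trans (mapMaybe-mapMaybe (mark t ∘ splitAt p) unsuc W)
                        (mapMaybe-cong (mark->>=unsuc t ∘ splitAt p) W)

  h-trace : ∀ i t → h (suc i) zero (trace t) ≡ h (i ↑ˡ q) (p ↑ʳ t) W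
  h-trace i t = h-mapMaybe _ (splitAt-onlyPreimage (mark-onlyPreimage-inj₁ t i))
                             (splitAt-onlyPreimage (mark-onlyPreimage-inj₂ t)) W

injection⇒≤length : ∀ {A : Set} {q} {xs : List A} (f : Fin q → A) →
  (∀ {t t'} → f t ≡ f t' → t ≡ t') → (∀ t → f t ∈ xs) → q ≤ length xs
injection⇒≤length {xs = xs} f f-injective f∈xs = injective⇒≤ {f = index ∘ f∈xs} λ {t} {t'} index≡ →
  f-injective (begin
    f t                          ≡⟨ lookup-index (f∈xs t) ⟩
    lookup xs (index (f∈xs t))   ≡⟨ cong (lookup xs) index≡ ⟩
    lookup xs (index (f∈xs t'))  ≡⟨ lookup-index (f∈xs t') ⟨
    f t'                         ∎)
  where open ≡-Reasoning

module _ {p q : ℕ} {R : Fin p → Fin q → Set} {L : Language} {W : List (Fin (p + q))}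
         (rep : Represents L (bipartite R) W) where

  open Traces {p} {q} W

  private
    occurrences≤maxLength′ : ∀ {u v} → Adj (bipartite R) u v → occurrences u W ≤ maxLength L
    occurrences≤maxLength′ = occurrences≤maxLength {G = bipartite R} {W = W} rep

  R⇔h-trace∈ : ∀ i t → R i t ⇔ (h (suc i) zero (trace t) ∈ L)
  R⇔h-trace∈ i t = mk⇔
    (λ r → subst (_∈ L) (sym (h-trace i t))
             (proj₂ (Equivalence.to (rep _ _) (Equivalence.to (Adj-bipartite R i t) r))))
    (λ h∈L → Equivalence.from (Adj-bipartite R i t)
               (Equivalence.from (rep _ _) (↑ˡ≢↑ʳ i t , subst (_∈ L) (h-trace i t) h∈L)))

  trace-injective : (∀ {t t'} → (∀ i → R i t ⇔ R i t') → t ≡ t') →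
                    ∀ {t t'} → trace t ≡ trace t' → t ≡ t'
  trace-injective columns-injective {t} {t'} trace≡ = columns-injective λ i →
    ⇔-sym (R⇔h-trace∈ i t') ⇔-∘ subst (λ u → R i t ⇔ (h (suc i) zero u ∈ L)) trace≡ (R⇔h-trace∈ i t)

  length-traceA≤ : (∀ i → ∃ (R i)) → length traceA ≤ p * maxLength L
  length-traceA≤ rows-nonempty = occurrences≤⇒length≤* (maxLength L) traceA λ i →
    let t , r = rows-nonempty i in
    subst (_≤ maxLength L) (sym (occurrences-traceA i))
          (occurrences≤maxLength′ (Equivalence.to (Adj-bipartite R i t) r))

  trace∈interleavings : (∀ t → ∃ λ i → R i t) → ∀ t → trace t ∈ interleavings (maxLength L) traceA
  trace∈interleavings columns-nonempty t =
    let i , r = columns-nonempty t in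
    subst (λ xs → trace t ∈ interleavings (maxLength L) xs) (unsuc-trace t)
      (∈-interleavings (maxLength L) (trace t)
        (subst (_≤ maxLength L) (sym (occurrences-zero-trace t))
          (occurrences≤maxLength′ (Graph.sym (bipartite R) _ _ (Equivalence.to (Adj-bipartite R i t) r)))))

  bipartite-size-bound : (∀ i → ∃ (R i)) → (∀ t → ∃ λ i → R i t) →
                         (∀ {t t'} → (∀ i → R i t ⇔ R i t') → t ≡ t') →
                         q ≤ (2 + p * maxLength L) ^ maxLength L
  bipartite-size-bound rows-nonempty columns-nonempty columns-injective = begin
    q
      ≤⟨ injection⇒≤length trace (trace-injective columns-injective) (trace∈interleavings columns-nonempty) ⟩
    length (interleavings (maxLength L) traceA)
      ≤⟨ length-interleavings (maxLength L) traceA ⟩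
    (2 + length traceA) ^ maxLength L
      ≤⟨ ^-monoˡ-≤ (maxLength L) (+-monoʳ-≤ 2 (length-traceA≤ rows-nonempty)) ⟩
    (2 + p * maxLength L) ^ maxLength L
      ∎
    where open ≤-Reasoning

-- Exponential versus polynomial growth

n<2^n : ∀ n → n < 2 ^ n
n<2^n zero    = s≤s z≤n
n<2^n (suc n) = begin-strict
  suc n          <⟨ s≤s (n<2^n n) ⟩
  suc (2 ^ n)    ≤⟨ +-monoˡ-≤ (2 ^ n) (m^n>0 2 n) ⟩
  2 ^ n + 2 ^ n  ≡⟨ cong (2 ^ n +_) (+-identityʳ (2 ^ n)) ⟨
  2 ^ suc n      ∎
  where open ≤-Reasoning

linear<exponential : ∀ a b → ∃ λ r → a * r + b < 2 ^ r
linear<exponential a b = c + c , (begin-strict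
  a * (c + c) + b        ≡⟨ regroup a c b ⟩
  (a + a) * c + b        ≤⟨ +-mono-≤ (*-monoˡ-≤ c (m≤m+n (a + a) b)) (m≤n+m b (a + a)) ⟩
  c * c + c              <⟨ s≤s (m≤m+n (c * c + c) c) ⟩
  suc (c * c + c + c)    ≡⟨ square-suc c ⟨
  suc c * suc c          ≤⟨ *-mono-≤ (n<2^n c) (n<2^n c) ⟩
  2 ^ c * 2 ^ c          ≡⟨ ^-distribˡ-+-* 2 c c ⟨
  2 ^ (c + c)            ∎)
  where
    open ≤-Reasoning
    c = a + a + b
    regroup : ∀ a c b → a * (c + c) + b ≡ (a + a) * c + b
    regroup = solve-∀
    square-suc : ∀ c → suc c * suc c ≡ suc (c * c + c + c)
    square-suc = solve-∀

2+[1+x]*N≤x*2^[1+N] : ∀ x N → 0 < x → 2 + suc x * N ≤ x * 2 ^ suc N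
2+[1+x]*N≤x*2^[1+N] x N 0<x = begin
  2 + suc x * N        ≡⟨ regroup x N ⟩
  1 * (2 + N) + x * N  ≤⟨ +-monoˡ-≤ (x * N) (*-monoˡ-≤ (2 + N) 0<x) ⟩
  x * (2 + N) + x * N  ≡⟨ double x N ⟩
  x * (2 * suc N)      ≤⟨ *-monoʳ-≤ x (*-monoʳ-≤ 2 (n<2^n N)) ⟩
  x * 2 ^ suc N        ∎
  where
    open ≤-Reasoning
    regroup : ∀ x N → 2 + suc x * N ≡ 1 * (2 + N) + x * N
    regroup = solve-∀
    double : ∀ x N → x * (2 + N) + x * N ≡ x * (2 * suc N)
    double = solve-∀

-- Opaque: otherwise a `with` on it makes Agda normalise the huge witness 2 ^ r.
opaque
  polynomial<exponential : ∀ N → ∃ λ m → (2 + suc m * N) ^ N < 2 ^ m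
  polynomial<exponential N with linear<exponential N (suc N * N)
  ... | r , Nr+[1+N]N<2^r = 2 ^ r , (begin-strict
    (2 + suc (2 ^ r) * N) ^ N  ≤⟨ ^-monoˡ-≤ N (2+[1+x]*N≤x*2^[1+N] (2 ^ r) N (m^n>0 2 r)) ⟩
    (2 ^ r * 2 ^ suc N) ^ N    ≡⟨ cong (_^ N) (^-distribˡ-+-* 2 r (suc N)) ⟨
    (2 ^ (r + suc N)) ^ N      ≡⟨ ^-*-assoc 2 (r + suc N) N ⟩
    2 ^ ((r + suc N) * N)      <⟨ ^-monoʳ-< 2 (s≤s (s≤s z≤n)) (subst (_< 2 ^ r) (expand r N) Nr+[1+N]N<2^r) ⟩
    2 ^ 2 ^ r                  ∎)
    where
      open ≤-Reasoning
      expand : ∀ r N → N * r + suc N * N ≡ (r + suc N) * N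
      expand = solve-∀

-- The graph of binary digits

funToFin-cong : ∀ {m n} {f g : Fin m → Fin n} → f ≗ g → funToFin f ≡ funToFin g
funToFin-cong {zero}  f≗g = refl
funToFin-cong {suc m} f≗g = cong₂ combine (f≗g zero) (funToFin-cong {m} (f≗g ∘ suc))

finToFun-injective : ∀ {m n} {t t' : Fin (n ^ m)} → finToFun {n} {m} t ≗ finToFun t' → t ≡ t'
finToFun-injective {m} {n} {t} {t'} t≗t' = begin
  t                                ≡⟨ funToFin-finToFin {m} {n} t ⟨
  funToFin (finToFun {n} {m} t)    ≡⟨ funToFin-cong {m} {n} t≗t' ⟩
  funToFin (finToFun {n} {m} t')   ≡⟨ funToFin-finToFin {m} {n} t' ⟩
  t'                               ∎
  where open ≡-Reasoning

≡1⇔≡1⇒≡ : ∀ {x y : Fin 2} → (x ≡ suc zero ⇔ y ≡ suc zero) → x ≡ y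
≡1⇔≡1⇒≡ {zero}     {zero}     _   = refl
≡1⇔≡1⇒≡ {zero}     {suc zero} x⇔y with () ← Equivalence.from x⇔y refl
≡1⇔≡1⇒≡ {suc zero} {zero}     x⇔y with () ← Equivalence.to x⇔y refl
≡1⇔≡1⇒≡ {suc zero} {suc zero} _   = refl

bitLink : ∀ {m} → Fin (suc m) → Fin (2 ^ m) → Set
bitLink         zero    t = ⊤
bitLink {m = m} (suc i) t = finToFun {2} {m} t i ≡ suc zero

ones : ∀ {m} → Fin (2 ^ m)
ones {m} = funToFin {m} {2} (λ _ → suc zero)

bitLink-ones : ∀ {m} (i : Fin (suc m)) → bitLink i (ones {m})
bitLink-ones         zero    = tt
bitLink-ones {m = m} (suc i) = finToFun-funToFin {m} {2} (λ _ → suc zero) i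

bitLink-columns-injective : ∀ {m} {t t' : Fin (2 ^ m)} → (∀ i → bitLink i t ⇔ bitLink i t') → t ≡ t'
bitLink-columns-injective {m} bitLink⇔ = finToFun-injective {m} {2} (≡1⇔≡1⇒≡ ∘ bitLink⇔ ∘ suc)

bitGraph-¬representable : ∀ {L} m → (2 + suc m * maxLength L) ^ maxLength L < 2 ^ m →
                          ¬ Representable L (bipartite (bitLink {m}))
bitGraph-¬representable m polynomial<2^m representable
  with representable⇒represented {G = bipartite (bitLink {m})} representable
... | W , rep = <⇒≱ polynomial<2^m
  (bipartite-size-bound {R = bitLink {m}} {W = W} rep
    (λ i → ones {m} , bitLink-ones i) (λ t → zero , tt) (bitLink-columns-injective {m}))

mainTheorem4 : (L : Language) → ZeroOneSymmetric L →
    Σ ℕ λ k → Σ (Graph (suc k)) λ G → ¬ Representable L G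
mainTheorem4 L _ with polynomial<exponential (maxLength L)
... | m , polynomial<2^m = m + 2 ^ m , bipartite (bitLink {m}) , bitGraph-¬representable m polynomial<2^m
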